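{- Let $n$ be an even integer and $k$ an integer with $1 \leq k \leq n/2 - 1$, and let $G_{n,k}$ be the convex geometric graph defined in the context. Then $G_{n,k}$ does not contain $k+1$ pairwise disjoint edges.
   Context: Let $P$ be a regular $2n$-gon inscribed in a circle, whose vertices are labelled cyclically by $-n+1,\dots,0,\dots,n$; labels are taken modulo $2n$ with representatives in $\{ -n+1,\dots,n\}$ (e.g. the vertex labelled $t$ is the point at angle $\pi t/n$). For even $n$, the vertex set $V(G)$ of the convex geometric graph is the set of the $n$ odd-labelled vertices of $P$, and edges are straight segments between them. An edge $\{a,b\}$ is said to be in direction $i$ (for an integer $i$) if $a+b \equiv 2i \pmod{2n}$; directions $i$ and $i+n$ coincide. For an integer $i$ and an integer $j$ with $0 \leq j \leq n-2k$ and $j \equiv i \pmod 2$, let $B_{i,j}$ be the set of $k$ parallel edges $\{\,\{i-d,\,i+d\} : d = n-2k-j+1+2t,\ t = 0,1,\dots,k-1\,\}$ (labels mod $2n$); equivalently, $B_{i,j}$ is the set of $k$ consecutive edges in direction $i$ such that exactly $j$ vertices of $V(G)$ lie in the open arc cut off by the extreme edges on the side not containing the vertex labelled $i$ (and $n-2k-j$ on the side containing $i$). Let $m=(n-2k)/2$. The graph $G_{n,k}$ has vertex set $V(G)$ and edge set $\bigcup_{j=-m}^{m} B_{j,|j|} \ \cup\ \bigcup_{i=0}^{2k} B_{m+i,\,m-\epsilon_i}$, where $\epsilon_i = 0$ if $i$ is even and $\epsilon_i=1$ if $i$ is odd. (It has exactly $k$ edges in each of the $n$ directions and avoids the set $\{\pm1,\pm3,\dots,\pm(2m-1)\}$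 of $n-2k$ consecutive vertices.) -}

module Defs where

open import Data.Nat as ℕ using (ℕ; zero; suc; _<_; _≤_)
open import Data.Integer as ℤ using (ℤ; +_; -_; _%ℕ_)
open import Data.Fin using (Fin)
open import Data.Product using (Σ; _×_; _,_; ∃)
open import Data.Sum using (_⊎_)
open import Relation.Binary.PropositionalEquality using (_≡_; _≢_)
open import Function.Bundles using (_⇔_)

-- Reduction of an integer label modulo N, as a natural number in [0, N)
-- (for N = 0 we return 0; this case never arises below since n ≥ 4).
modN : ℤ → ℕ → ℕ
modN x zero    = 0
modN x (suc N) = x %ℕ suc N

-- Position on the 2n-gon of the vertex with label x: the vertex labelled t is the
-- point at angle π t / n, so positions 0,1,…,2n-1 are in cyclic (counterclockwise) order.
pos : ℕ → ℤ → ℕ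
pos n x = modN x (2 ℕ.* n)

Edge : Set
Edge = ℕ × ℕ

-- x lies strictly between the endpoints of the chord (a , b) in the linear order of
-- positions (i.e. on one of the two open arcs cut off by the chord).
StrictlyBetween : ℕ → ℕ → ℕ → Set
StrictlyBetween a b x = (a < x × x < b) ⊎ (b < x × x < a)

-- Two straight segments between vertices of a convex polygon are disjoint iff they share
-- no endpoint and do not cross, i.e. the endpoints of the second chord lie on the same
-- side of the first chord.
Disjoint : Edge → Edge → Set
Disjoint (a , b) (c , d) =
  (a ≢ c) × (a ≢ d) × (b ≢ c) × (b ≢ d) ×
  (StrictlyBetween a b c ⇔ StrictlyBetween a b d)

-- The t-th edge of B_{i,j}:  {i-d, i+d} with d = n - 2k - j + 1 + 2t  (as labels in ℤ).
bEdge : ℕ → ℕ → ℤ → ℤ → ℕ → Edge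
bEdge n k i j t =
  let d = + n ℤ.- + (2 ℕ.* k) ℤ.- j ℤ.+ + 1 ℤ.+ + (2 ℕ.* t)
  in pos n (i ℤ.- d) , pos n (i ℤ.+ d)

InB : ℕ → ℕ → ℤ → ℤ → Edge → Set
InB n k i j (p , q) =
  Σ ℕ λ t → t < k × ((bEdge n k i j t ≡ (p , q)) ⊎ (bEdge n k i j t ≡ (q , p)))

ε : ℕ → ℕ
ε i = i ℕ.% 2

IsEdgeG : ℕ → ℕ → Edge → Set
IsEdgeG n k e =
  let m = (n ℕ.∸ 2 ℕ.* k) ℕ./ 2 in
  (Σ ℤ λ j → (ℤ.- + m ℤ.≤ j) × (j ℤ.≤ + m) × InB n k j (+ ℤ.∣ j ∣) e)
  ⊎ (Σ ℕ λ i → (i ≤ 2 ℕ.* k) × InB n k (+ (m ℕ.+ i)) (+ m ℤ.- + ε i) e)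

HasDisjointEdges : ℕ → ℕ → ℕ → Set
HasDisjointEdges n k r =
  Σ (Fin r → Edge) λ e →
    ((x : Fin r) → IsEdgeG n k (e x)) ×
    ((x y : Fin r) → x ≢ y → Disjoint (e x) (e y))

{-# OPTIONS --safe #-}
-- Number the n vertices of G by 0, …, n − 1, vertex v being the point at position 2v + 1,
-- and put h = n/2 = m + k. Every edge of G is a chord (u, w), u < w, such that a chord of
-- the lower half (w < h) has at least m vertices strictly inside it, a chord of the upper
-- half (h ≤ u) at least m − 1, and a chord crossing the middle with u < m ends below h + k.
-- Disjoint edges form a non-crossing family with distinct endpoints, and among its lower
-- (or upper) chords there is one with no endpoint of the family strictly inside it.
-- Now suppose there are k + 1 disjoint edges. With both lower and upper chords, the 2k + 2
-- endpoints avoid the inside of such a lower and such an upper chord, so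
-- 2k + 2 + m + (m − 1) ≤ 2h, which is false. With lower but no upper chords, the k + 1 left
-- endpoints lie below h and avoid the inside and the right end of such a lower chord, so
-- k + 1 + m + 1 ≤ h; dually without lower chords. If every chord crosses the middle, then
-- either all left endpoints lie in [m, h) or, by non-crossing, all right endpoints lie in
-- [h, h + k); both intervals have only k places.

module Submission where

open import Defs
open import Data.Nat using (ℕ; suc; _≤_; _+_; _*_)
open import Data.Nat.Divisibility using (_∣_)
open import Relation.Nullary using (¬_)
open import Data.Nat using (_∸_; _<_; _/_; _%_; _≤?_; _<?_; z≤n; s≤s; z<s)
open import Data.Nat.Properties
open import Data.Nat.DivMod using (m<n⇒m%n≡m; m*n/n≡m; m≡m%n+[m/n]*n; m%n<n)
open import Data.Nat.Divisibility using (divides)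
open import Data.Nat.Induction using (<-wellFounded)
open import Data.Nat.Tactic.RingSolver using (solve)
open import Data.Integer as ℤ using (+_; -[1+_]; _⊖_; +≤+)
open import Data.Integer.Properties using (⊖-≥; ⊖-<; m-n≡m⊖n; neg-cancel-≤)
open import Data.Integer.Tactic.RingSolver using (solve-∀)
open import Data.Fin using (Fin; fromℕ<; toℕ; splitAt; join)
open import Data.Fin.Properties using (injective⇒≤; toℕ-fromℕ<; any?; join-splitAt)
  renaming (_≟_ to _≟ᶠ_)
open import Data.Empty using (⊥; ⊥-elim)
open import Data.List using (_∷_; [])
open import Data.Product using (∃; _×_; _,_; proj₁; proj₂)
open import Data.Sum using (_⊎_; inj₁; inj₂; [_,_]′; swap)
open import Function using (_∘_; _⇔_; mk⇔; Equivalence)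
open import Function.Definitions using (Injective)
import Function.Properties.Equivalence as ⇔
open import Induction.WellFounded using (Acc; acc)
open import Relation.Binary.PropositionalEquality
open import Relation.Nullary using (Dec; yes; no; contradiction)
open import Relation.Nullary.Decidable using (_×-dec_)

≤-witness : ∀ {x y} c → x + c ≡ y → x ≤ y
≤-witness {x} c refl = m≤m+n x c

<-witness : ∀ {x y} c → x + suc c ≡ y → suc x ≤ y
<-witness {x} c refl = m<m+n x z<s

refute-< : ∀ {x y} → x < y → ∀ c → y + c ≡ x → ⊥
refute-< {y = y} x<y c refl = ≤⇒≯ (m≤m+n y c) x<y

refute-≤ : ∀ {x y} → x ≤ y → ∀ c → y + suc c ≡ x → ⊥
refute-≤ x≤y c refl = m+1+n≰m _ x≤y

-- Counting points that avoid gaps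

bounded-injection⇒≤ : ∀ {r N} (f : Fin r → ℕ) → Injective _≡_ _≡_ f → (∀ x → f x < N) → r ≤ N
bounded-injection⇒≤ f f-injective f<N = injective⇒≤ {f = λ x → fromℕ< (f<N x)} λ {x} {y} eq →
  f-injective (begin
    f x                  ≡⟨ toℕ-fromℕ< (f<N x) ⟨
    toℕ (fromℕ< (f<N x)) ≡⟨ cong toℕ eq ⟩
    toℕ (fromℕ< (f<N y)) ≡⟨ toℕ-fromℕ< (f<N y) ⟩
    f y                  ∎)
  where open ≡-Reasoning

Avoids : ℕ → ℕ → ℕ → Set
Avoids a b v = v < a ⊎ b ≤ v

avoids-shrink : ∀ {a b b′ v} → b′ ≤ b → Avoids a b v → Avoids a b′ v
avoids-shrink _    (inj₁ v<a) = inj₁ v<a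
avoids-shrink b′≤b (inj₂ b≤v) = inj₂ (≤-trans b′≤b b≤v)

closeGap : ∀ {a d v} → Avoids a (a + d) v → ℕ
closeGap {v = v}         (inj₁ _) = v
closeGap {d = d} {v = v} (inj₂ _) = v ∸ d

closeGap-injective : ∀ {a d v v′} (p : Avoids a (a + d) v) (p′ : Avoids a (a + d) v′) →
  closeGap p ≡ closeGap p′ → v ≡ v′
closeGap-injective     (inj₁ _)   (inj₁ _)    eq   = eq
closeGap-injective {a} (inj₂ q)   (inj₂ q′)   eq   = ∸-cancelʳ-≡ (m+n≤o⇒n≤o a q) (m+n≤o⇒n≤o a q′) eq
closeGap-injective {a} (inj₁ v<a) (inj₂ q′)   refl = contradiction v<a (≤⇒≯ (m+n≤o⇒m≤o∸n a q′))
closeGap-injective {a} (inj₂ q)   (inj₁ v′<a) refl = contradiction v′<a (≤⇒≯ (m+n≤o⇒m≤o∸n a q))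

closeGap-< : ∀ {a d v N} → a + d ≤ N → v < N → (p : Avoids a (a + d) v) → closeGap p < N ∸ d
closeGap-< {a} a+d≤N _   (inj₁ v<a) = <-≤-trans v<a (m+n≤o⇒m≤o∸n a a+d≤N)
closeGap-< {a} _     v<N (inj₂ q)   = ∸-monoˡ-< v<N (m+n≤o⇒n≤o a q)

closeGap-avoids : ∀ {a d a′ b′ v} → b′ ≤ a → Avoids a′ b′ v → (p : Avoids a (a + d) v) →
  Avoids a′ b′ (closeGap p)
closeGap-avoids     _    avoids (inj₁ _) = avoids
closeGap-avoids {a} b′≤a _      (inj₂ q) = inj₂ (≤-trans b′≤a (m+n≤o⇒m≤o∸n a q))

private
  module GapClosed {r a d} (f : Fin r → ℕ) (avoids : ∀ x → Avoids a (a + d) (f x)) where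

    g : Fin r → ℕ
    g x = closeGap (avoids x)

    g-injective : Injective _≡_ _≡_ f → Injective _≡_ _≡_ g
    g-injective f-injective eq = f-injective (closeGap-injective (avoids _) (avoids _) eq)

    g< : ∀ {N} → a + d ≤ N → (∀ x → f x < N) → ∀ x → g x < N ∸ d
    g< a+d≤N f<N x = closeGap-< a+d≤N (f<N x) (avoids x)

gap-bound : ∀ {r N a b d} (f : Fin r → ℕ) → Injective _≡_ _≡_ f →
  a + d ≤ b → b ≤ N → (∀ x → f x < N) → (∀ x → Avoids a b (f x)) → r + d ≤ N
gap-bound {r} {a = a} f f-injective a+d≤b b≤N f<N avoids =
  m≤o∸n⇒m+n≤o r (m+n≤o⇒n≤o a a+d≤N) (bounded-injection⇒≤ g (g-injective f-injective) (g< a+d≤N f<N))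
  where
  a+d≤N = ≤-trans a+d≤b b≤N
  open GapClosed f (λ x → avoids-shrink a+d≤b (avoids x))

two-gaps-bound : ∀ {r N a₁ b₁ d₁ a₂ b₂ d₂} (f : Fin r → ℕ) → Injective _≡_ _≡_ f →
  a₁ + d₁ ≤ b₁ → b₁ ≤ a₂ → a₂ + d₂ ≤ b₂ → b₂ ≤ N → (∀ x → f x < N) →
  (∀ x → Avoids a₁ b₁ (f x)) → (∀ x → Avoids a₂ b₂ (f x)) → r + d₁ + d₂ ≤ N
two-gaps-bound {r} {d₁ = d₁} {a₂ = a₂} f f-injective a₁+d₁≤b₁ b₁≤a₂ a₂+d₂≤b₂ b₂≤N f<N
  avoids₁ avoids₂ =
  m≤o∸n⇒m+n≤o (r + d₁) (m+n≤o⇒n≤o a₂ a₂+d₂≤N)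
    (gap-bound g (g-injective f-injective) a₁+d₁≤b₁ (≤-trans b₁≤a₂ (m+n≤o⇒m≤o∸n a₂ a₂+d₂≤N))
      (g< a₂+d₂≤N f<N) (λ x → closeGap-avoids b₁≤a₂ (avoids₁ x) (avoids₂′ x)))
  where
  a₂+d₂≤N = ≤-trans a₂+d₂≤b₂ b₂≤N
  avoids₂′ = λ x → avoids-shrink a₂+d₂≤b₂ (avoids₂ x)
  open GapClosed f avoids₂′

-- Non-crossing families of chords

Inside : ℕ → ℕ → ℕ → Set
Inside u w v = u < v × v < w

inside? : ∀ u w v → Dec (Inside u w v)
inside? u w v = (u <? v) ×-dec (v <? w)

¬inside⇒avoids : ∀ {u w v} → ¬ Inside u w v → Avoids (suc u) w v
¬inside⇒avoids {u} {w} {v} ¬inside with v ≤? u | w ≤? v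
... | yes v≤u | _       = inj₁ (s≤s v≤u)
... | no _    | yes w≤v = inj₂ w≤v
... | no v≰u  | no w≰v  = contradiction (≰⇒> v≰u , ≰⇒> w≰v) ¬inside

¬inside∧≢hi⇒avoids : ∀ {u w v} → ¬ Inside u w v → v ≢ w → Avoids (suc u) (suc w) v
¬inside∧≢hi⇒avoids ¬inside v≢w with ¬inside⇒avoids ¬inside
... | inj₁ v≤u = inj₁ v≤u
... | inj₂ w≤v = inj₂ (≤∧≢⇒< w≤v (v≢w ∘ sym))

¬inside∧≢lo⇒avoids : ∀ {u w v} → ¬ Inside u w v → v ≢ u → Avoids u w v
¬inside∧≢lo⇒avoids ¬inside v≢u with ¬inside⇒avoids ¬inside
... | inj₁ v≤u = inj₁ (≤∧≢⇒< (≤-pred v≤u) v≢u)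
... | inj₂ w≤v = inj₂ w≤v

record NonCrossing (u w u′ w′ : ℕ) : Set where
  field
    u≢u′   : u ≢ u′
    u≢w′   : u ≢ w′
    w≢u′   : w ≢ u′
    w≢w′   : w ≢ w′
    nested : Inside u w u′ ⇔ Inside u w w′

module NonCrossingFamily {r} (lo hi : Fin r → ℕ) (lo<hi : ∀ x → lo x < hi x)
  (non-crossing : ∀ {x y} → x ≢ y → NonCrossing (lo x) (hi x) (lo y) (hi y)) where

  open NonCrossing

  lo-injective : Injective _≡_ _≡_ lo
  lo-injective {x} {y} eq with x ≟ᶠ y
  ... | yes x≡y = x≡y
  ... | no x≢y  = contradiction eq (u≢u′ (non-crossing x≢y))

  hi-injective : Injective _≡_ _≡_ hi
  hi-injective {x} {y} eq with x ≟ᶠ y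
  ... | yes x≡y = x≡y
  ... | no x≢y  = contradiction eq (w≢w′ (non-crossing x≢y))

  lo≢hi : ∀ x y → lo x ≢ hi y
  lo≢hi x y with x ≟ᶠ y
  ... | yes refl = <⇒≢ (lo<hi x)
  ... | no x≢y   = u≢w′ (non-crossing x≢y)

  endpoint : Fin (r + r) → ℕ
  endpoint = [ lo , hi ]′ ∘ splitAt r

  endpoint-injective : Injective _≡_ _≡_ endpoint
  endpoint-injective {i} {j} eq = begin
    i                      ≡⟨ join-splitAt r r i ⟨
    join r r (splitAt r i) ≡⟨ cong (join r r) ([lo,hi]-injective {splitAt r i} {splitAt r j} eq) ⟩
    join r r (splitAt r j) ≡⟨ join-splitAt r r j ⟩
    j                      ∎
    where
    open ≡-Reasoning
    [lo,hi]-injective : Injective _≡_ _≡_ [ lo , hi ]′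
    [lo,hi]-injective {inj₁ x} {inj₁ y} eq = cong inj₁ (lo-injective eq)
    [lo,hi]-injective {inj₁ x} {inj₂ y} eq = contradiction eq (lo≢hi x y)
    [lo,hi]-injective {inj₂ x} {inj₁ y} eq = contradiction (sym eq) (lo≢hi y x)
    [lo,hi]-injective {inj₂ x} {inj₂ y} eq = cong inj₂ (hi-injective eq)

  lo-inside⇒hi-inside : ∀ {x y} → Inside (lo x) (hi x) (lo y) → Inside (lo x) (hi x) (hi y)
  lo-inside⇒hi-inside {x} {y} inside with x ≟ᶠ y
  ... | yes refl = contradiction (proj₁ inside) (<-irrefl refl)
  ... | no x≢y   = Equivalence.to (nested (non-crossing x≢y)) inside

  hi-inside⇒lo-inside : ∀ {x y} → Inside (lo x) (hi x) (hi y) → Inside (lo x) (hi x) (lo y)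
  hi-inside⇒lo-inside {x} {y} inside with x ≟ᶠ y
  ... | yes refl = contradiction (proj₂ inside) (<-irrefl refl)
  ... | no x≢y   = Equivalence.from (nested (non-crossing x≢y)) inside

  length : Fin r → ℕ
  length x = hi x ∸ lo x

  nested-shorter : ∀ {x y} → lo x < lo y → hi y < hi x → length y < length x
  nested-shorter {x} {y} lo<lo hi<hi =
    <-≤-trans (∸-monoˡ-< hi<hi (<⇒≤ (lo<hi y))) (∸-monoʳ-≤ (hi x) (<⇒≤ lo<lo))

  Empty : Fin r → Set
  Empty x = ∀ y → ¬ Inside (lo x) (hi x) (lo y)

  NestingClosed : (Fin r → Set) → Set
  NestingClosed P = ∀ {x y} → P x → lo x < lo y → hi y < hi x → P y

  empty-within : ∀ {P} → NestingClosed P → ∀ {x} → P x → ∃ λ y → P y × Empty y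
  empty-within {P} closed {x} = go x (<-wellFounded (length x))
    where
    go : ∀ x → Acc _<_ (length x) → P x → ∃ λ y → P y × Empty y
    go x (acc shorter) px with any? (λ y → inside? (lo x) (hi x) (lo y))
    ... | no none = x , px , λ y inside → none (y , inside)
    ... | yes (y , inside) = go y (shorter (nested-shorter lo<lo hi<hi)) (closed px lo<lo hi<hi)
      where
      lo<lo = proj₁ inside
      hi<hi = proj₂ (lo-inside⇒hi-inside inside)

  module _ {x} (empty : Empty x) where

    empty⇒endpoint-avoids : ∀ i → Avoids (suc (lo x)) (hi x) (endpoint i)
    empty⇒endpoint-avoids i with splitAt r i
    ... | inj₁ y = ¬inside⇒avoids (empty y)
    ... | inj₂ y = ¬inside⇒avoids (empty y ∘ hi-inside⇒lo-inside)

    empty⇒lo-avoids : ∀ y → Avoids (suc (lo x)) (suc (hi x)) (lo y)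
    empty⇒lo-avoids y = ¬inside∧≢hi⇒avoids (empty y) (lo≢hi y x)

    empty⇒hi-avoids : ∀ y → Avoids (lo x) (hi x) (hi y)
    empty⇒hi-avoids y = ¬inside∧≢lo⇒avoids (empty y ∘ hi-inside⇒lo-inside) (lo≢hi x y ∘ sym)

-- Admissible chords

record Admissible (m k u w : ℕ) : Set where
  field
    u<w            : u < w
    w<2h           : w < 2 * (m + k)
    lower-long     : w < m + k → u + suc m ≤ w
    upper-long     : m + k ≤ u → u + m ≤ w
    crossing-short : u < m → m + k ≤ w → w < (m + k) + k

module _ (m′ k : ℕ) {lo hi : Fin (suc k) → ℕ}
  (admissible : ∀ x → Admissible (suc m′) k (lo x) (hi x))
  (non-crossing : ∀ {x y} → x ≢ y → NonCrossing (lo x) (hi x) (lo y) (hi y)) where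

  private
    m = suc m′
    h = m + k

  open Admissible
  open NonCrossingFamily lo hi (u<w ∘ admissible) non-crossing

  -- The counting identities below spell out h as suc m′ + k: the ring solver does not
  -- unfold local definitions.

  Lower Upper : Fin (suc k) → Set
  Lower x = hi x < h
  Upper x = h ≤ lo x

  lower-closed : NestingClosed Lower
  lower-closed lower _ hi<hi = <-trans hi<hi lower

  upper-closed : NestingClosed Upper
  upper-closed upper lo<lo _ = ≤-trans upper (<⇒≤ lo<lo)

  endpoint<2h : ∀ i → endpoint i < 2 * h
  endpoint<2h i with splitAt (suc k) i
  ... | inj₁ y = <-trans (u<w (admissible y)) (w<2h (admissible y))
  ... | inj₂ y = w<2h (admissible y)

  lower-and-upper : ∀ {x y} → Lower x → Upper y → ⊥
  lower-and-upper lower upper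
    with x , lower-x , empty-x ← empty-within lower-closed lower
       | y , upper-y , empty-y ← empty-within upper-closed upper =
    refute-≤ (two-gaps-bound endpoint endpoint-injective
      (gap (lower-long (admissible x) lower-x)) (≤-trans (<⇒≤ lower-x) (≤-trans upper-y (n≤1+n _)))
      (gap (upper-long (admissible y) upper-y)) (<⇒≤ (w<2h (admissible y)))
      endpoint<2h (empty⇒endpoint-avoids empty-x) (empty⇒endpoint-avoids empty-y)) 0 2h+1
    where
    gap : ∀ {u w d} → u + suc d ≤ w → suc u + d ≤ w
    gap {u} {w} {d} = subst (_≤ w) (+-suc u d)
    2h+1 : 2 * (suc m′ + k) + 1 ≡ suc k + suc k + suc m′ + m′
    2h+1 = solve (m′ ∷ k ∷ [])

  lower-without-upper : ∀ {x} → Lower x → (∀ y → lo y < h) → ⊥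
  lower-without-upper lower lo<h with x , lower-x , empty-x ← empty-within lower-closed lower =
    refute-≤ (gap-bound lo lo-injective (s≤s (lower-long (admissible x) lower-x)) lower-x
      lo<h (empty⇒lo-avoids empty-x)) 1 h+2
    where
    h+2 : suc m′ + k + 2 ≡ suc k + suc (suc m′)
    h+2 = solve (m′ ∷ k ∷ [])

  upper-without-lower : ∀ {x} → Upper x → (∀ y → h ≤ hi y) → ⊥
  upper-without-lower upper h≤hi with x , upper-x , empty-x ← empty-within upper-closed upper =
    refute-≤ (two-gaps-bound {a₁ = 0} hi hi-injective ≤-refl upper-x
      (upper-long (admissible x) upper-x) (<⇒≤ (w<2h (admissible x)))
      (w<2h ∘ admissible) (inj₂ ∘ h≤hi) (empty⇒hi-avoids empty-x)) 0 2h+1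
    where
    2h+1 : 2 * (suc m′ + k) + 1 ≡ suc k + (suc m′ + k) + suc m′
    2h+1 = solve (m′ ∷ k ∷ [])

  all-crossing : (∀ y → lo y < h) → (∀ y → h ≤ hi y) → ⊥
  all-crossing lo<h h≤hi with any? (λ x → lo x <? m)
  ... | no none =
    refute-≤ (gap-bound {a = 0} lo lo-injective ≤-refl (m≤m+n m k) lo<h
      (λ y → inj₂ (≮⇒≥ (none ∘ (y ,_))))) 0 h+1
    where
    h+1 : suc m′ + k + 1 ≡ suc k + suc m′
    h+1 = solve (m′ ∷ k ∷ [])
  ... | yes (x , lo<m) =
    refute-≤ (gap-bound {a = 0} hi hi-injective ≤-refl (m≤m+n h k) hi<h+k (inj₂ ∘ h≤hi)) 0 h+k+1
    where
    h+k+1 : suc m′ + k + k + 1 ≡ suc k + (suc m′ + k)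
    h+k+1 = solve (m′ ∷ k ∷ [])
    hi<h+k : ∀ y → hi y < h + k
    hi<h+k y with lo y ≤? lo x
    ... | yes lo≤lo = crossing-short (admissible y) (≤-<-trans lo≤lo lo<m) (h≤hi y)
    ... | no lo≰lo  = <-trans (proj₂ (lo-inside⇒hi-inside (≰⇒> lo≰lo , <-≤-trans (lo<h y) (h≤hi x))))
                              (crossing-short (admissible x) lo<m (h≤hi x))

  no-admissible-non-crossing-family : ⊥
  no-admissible-non-crossing-family with any? (λ x → hi x <? h) | any? (λ x → h ≤? lo x)
  ... | yes (_ , lower) | yes (_ , upper) = lower-and-upper lower upper
  ... | yes (_ , lower) | no no-upper     = lower-without-upper lower (λ y → ≰⇒> (no-upper ∘ (y ,_)))
  ... | no no-lower     | yes (_ , upper) = upper-without-lower upper (λ y → ≮⇒≥ (no-lower ∘ (y ,_)))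
  ... | no no-lower     | no no-upper     =
    all-crossing (λ y → ≰⇒> (no-upper ∘ (y ,_))) (λ y → ≮⇒≥ (no-lower ∘ (y ,_)))

-- Vertices and their positions

vertex : ℕ → ℕ
vertex v = suc (2 * v)

vertex-< : ∀ {v N} → v < N → vertex v < 2 * N
vertex-< {v} {N} v<N = subst (_≤ 2 * N) (*-suc 2 v) (*-monoʳ-≤ 2 v<N)

vertex-mono-< : ∀ {u v} → u < v → vertex u < vertex v
vertex-mono-< u<v = s≤s (*-monoʳ-< 2 u<v)

vertex-cancel-< : ∀ {u v} → vertex u < vertex v → u < v
vertex-cancel-< {u} {v} lt = *-cancelˡ-< 2 u v (≤-pred lt)

modN-+ : ∀ {N x} → x < N → modN (+ x) N ≡ x
modN-+ {suc N} x<N = m<n⇒m%n≡m x<N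

modN-negative : ∀ {N c} → suc c < N → modN -[1+ c ] N ≡ N ∸ suc c
modN-negative {suc N} 1+c<N rewrite m<n⇒m%n≡m 1+c<N = refl

ReducesTo : ℕ → ℕ → ℕ → ℕ → Set
ReducesTo N P Q x = P ≡ Q + x ⊎ P + N ≡ Q + x

modN-⊖ : ∀ {N} P Q {y} → suc y < N → ReducesTo N P Q (suc y) → modN (P ⊖ Q) N ≡ suc y
modN-⊖ {N} P Q {y} 1+y<N (inj₁ refl) = begin
  modN ((Q + suc y) ⊖ Q) N    ≡⟨ cong (λ z → modN z N) (⊖-≥ (m≤m+n Q (suc y))) ⟩
  modN (+ (Q + suc y ∸ Q)) N  ≡⟨ cong (λ z → modN (+ z) N) (m+n∸m≡n Q (suc y)) ⟩
  modN (+ suc y) N            ≡⟨ modN-+ 1+y<N ⟩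
  suc y                       ∎
  where open ≡-Reasoning
modN-⊖ {N} P Q {y} 1+y<N (inj₂ wraps) with c , refl ← m≤n⇒∃[o]m+o≡n 1+y<N
  with refl ← +-cancelʳ-≡ (suc y) Q (P + suc c) (trans (sym wraps) (solve (P ∷ y ∷ c ∷ []))) = begin
  modN (P ⊖ (P + suc c)) N        ≡⟨ cong (λ z → modN z N) (⊖-< (m<m+n P z<s)) ⟩
  modN (ℤ.- + (P + suc c ∸ P)) N  ≡⟨ cong (λ z → modN (ℤ.- + z) N) (m+n∸m≡n P (suc c)) ⟩
  modN -[1+ c ] N                 ≡⟨ modN-negative (s≤s (s≤s (m≤n+m c y))) ⟩
  suc (suc y) + c ∸ suc c         ≡⟨ cong (_∸ suc c) (+-suc (suc y) c) ⟨
  suc y + suc c ∸ suc c           ≡⟨ m+n∸n≡m (suc y) (suc c) ⟩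
  suc y                           ∎
  where open ≡-Reasoning

pos-vertex : ∀ n P Q {v} → v < n → ReducesTo (2 * n) P Q (vertex v) → pos n (P ⊖ Q) ≡ vertex v
pos-vertex n P Q v<n = modN-⊖ P Q (vertex-< v<n)

strictlyBetween-vertex⇔inside : ∀ {u w v} → u < w →
  StrictlyBetween (vertex u) (vertex w) (vertex v) ⇔ Inside u w v
strictlyBetween-vertex⇔inside u<w = mk⇔ to from
  where
  to : StrictlyBetween _ _ _ → Inside _ _ _
  to (inj₁ (p , q)) = vertex-cancel-< p , vertex-cancel-< q
  to (inj₂ (p , q)) = contradiction (<-trans p q) (<⇒≯ (vertex-mono-< u<w))
  from : Inside _ _ _ → StrictlyBetween _ _ _
  from (p , q) = inj₁ (vertex-mono-< p , vertex-mono-< q)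

Joins : Edge → ℕ → ℕ → Set
Joins e u w = e ≡ (vertex u , vertex w) ⊎ e ≡ (vertex w , vertex u)

joins-reorient : ∀ {e p q u w} → Joins e u w → e ≡ (p , q) ⊎ e ≡ (q , p) → Joins (p , q) u w
joins-reorient (inj₁ refl) (inj₁ refl) = inj₁ refl
joins-reorient (inj₁ refl) (inj₂ refl) = inj₂ refl
joins-reorient (inj₂ refl) (inj₁ refl) = inj₂ refl
joins-reorient (inj₂ refl) (inj₂ refl) = inj₁ refl

disjoint-swapˡ : ∀ {a b c d} → Disjoint (a , b) (c , d) → Disjoint (b , a) (c , d)
disjoint-swapˡ (a≢c , a≢d , b≢c , b≢d , between) =
  b≢c , b≢d , a≢c , a≢d , ⇔.trans reverse (⇔.trans between reverse)
  where
  reverse : ∀ {a b x} → StrictlyBetween b a x ⇔ StrictlyBetween a b x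
  reverse = mk⇔ swap swap

disjoint-swapʳ : ∀ {a b c d} → Disjoint (a , b) (c , d) → Disjoint (a , b) (d , c)
disjoint-swapʳ (a≢c , a≢d , b≢c , b≢d , between) = a≢d , a≢c , b≢d , b≢c , ⇔.sym between

joins-disjoint : ∀ {e e′ u w u′ w′} → Joins e u w → Joins e′ u′ w′ → Disjoint e e′ →
  Disjoint (vertex u , vertex w) (vertex u′ , vertex w′)
joins-disjoint (inj₁ refl) (inj₁ refl) = λ disjoint → disjoint
joins-disjoint (inj₂ refl) (inj₁ refl) = disjoint-swapˡ
joins-disjoint (inj₁ refl) (inj₂ refl) = disjoint-swapʳ
joins-disjoint (inj₂ refl) (inj₂ refl) = disjoint-swapˡ ∘ disjoint-swapʳ

disjoint⇒non-crossing : ∀ {u w u′ w′} → u < w →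
  Disjoint (vertex u , vertex w) (vertex u′ , vertex w′) → NonCrossing u w u′ w′
disjoint⇒non-crossing u<w (a≢c , a≢d , b≢c , b≢d , between) = record
  { u≢u′   = a≢c ∘ cong vertex
  ; u≢w′   = a≢d ∘ cong vertex
  ; w≢u′   = b≢c ∘ cong vertex
  ; w≢w′   = b≢d ∘ cong vertex
  ; nested = ⇔.trans (⇔.sym (strictlyBetween-vertex⇔inside u<w))
                     (⇔.trans between (strictlyBetween-vertex⇔inside u<w))
  }

-- The edges of G

record AdmissibleChord (m k : ℕ) (e : Edge) : Set where
  constructor chord
  field
    {lo hi}    : ℕ
    admissible : Admissible m k lo hi
    joins      : Joins e lo hi

chord-reorient : ∀ {m k e p q} → AdmissibleChord m k e → e ≡ (p , q) ⊎ e ≡ (q , p) →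
  AdmissibleChord m k (p , q)
chord-reorient (chord {u} {w} admissible joins) orientation =
  chord admissible (joins-reorient {u = u} {w = w} joins orientation)

chords-non-crossing : ∀ {m k e e′} (c : AdmissibleChord m k e) (c′ : AdmissibleChord m k e′) →
  Disjoint e e′ → let open AdmissibleChord in NonCrossing (lo c) (hi c) (lo c′) (hi c′)
chords-non-crossing (chord {u} {w} admissible joins) (chord {u′} {w′} _ joins′) disjoint =
  disjoint⇒non-crossing (Admissible.u<w admissible)
    (joins-disjoint {u = u} {w} {u′} {w′} joins joins′ disjoint)

-- The two endpoints i ∓ d of an edge are written as differences P ⊖ Q of naturals, and the
-- vertex they land on is stated as 1 + 2 * x rather than vertex x, so that the ring
-- solver on ℕ can discharge the ReducesTo hypotheses.

bEdge-nonneg : ∀ n k t I J {x y} → x < n → y < n →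
  ReducesTo (2 * n) (I + 2 * k + J) (n + 1 + 2 * t) (1 + 2 * x) →
  ReducesTo (2 * n) (I + n + 1 + 2 * t) (2 * k + J) (1 + 2 * y) →
  bEdge n k (+ I) (+ J) t ≡ (vertex x , vertex y)
bEdge-nonneg n k t I J x<n y<n x-reduces y-reduces = cong₂ _,_
  (trans (cong (pos n) (trans (minus (+ I) (+ n) (+ (2 * k)) (+ J) (+ (2 * t)))
                              (m-n≡m⊖n (I + 2 * k + J) (n + 1 + 2 * t))))
         (pos-vertex n (I + 2 * k + J) (n + 1 + 2 * t) x<n x-reduces))
  (trans (cong (pos n) (trans (plus (+ I) (+ n) (+ (2 * k)) (+ J) (+ (2 * t)))
                              (m-n≡m⊖n (I + n + 1 + 2 * t) (2 * k + J))))
         (pos-vertex n (I + n + 1 + 2 * t) (2 * k + J) y<n y-reduces))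
  where
  minus : ∀ I N K J T → I ℤ.- (N ℤ.- K ℤ.- J ℤ.+ + 1 ℤ.+ T) ≡ (I ℤ.+ K ℤ.+ J) ℤ.- (N ℤ.+ + 1 ℤ.+ T)
  minus = solve-∀
  plus : ∀ I N K J T → I ℤ.+ (N ℤ.- K ℤ.- J ℤ.+ + 1 ℤ.+ T) ≡ (I ℤ.+ N ℤ.+ + 1 ℤ.+ T) ℤ.- (K ℤ.+ J)
  plus = solve-∀

bEdge-neg : ∀ n k t a {x y} → x < n → y < n →
  ReducesTo (2 * n) (2 * k) (n + 1 + 2 * t) (1 + 2 * x) →
  ReducesTo (2 * n) (n + 1 + 2 * t) (suc a + 2 * k + suc a) (1 + 2 * y) →
  bEdge n k -[1+ a ] (+ suc a) t ≡ (vertex x , vertex y)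
bEdge-neg n k t a x<n y<n x-reduces y-reduces = cong₂ _,_
  (trans (cong (pos n) (trans (minus (+ suc a) (+ n) (+ (2 * k)) (+ (2 * t)))
                              (m-n≡m⊖n (2 * k) (n + 1 + 2 * t))))
         (pos-vertex n (2 * k) (n + 1 + 2 * t) x<n x-reduces))
  (trans (cong (pos n) (trans (plus (+ suc a) (+ n) (+ (2 * k)) (+ (2 * t)))
                              (m-n≡m⊖n (n + 1 + 2 * t) (suc a + 2 * k + suc a))))
         (pos-vertex n (n + 1 + 2 * t) (suc a + 2 * k + suc a) y<n y-reduces))
  where
  minus : ∀ A N K T → ℤ.- A ℤ.- (N ℤ.- K ℤ.- A ℤ.+ + 1 ℤ.+ T) ≡ K ℤ.- (N ℤ.+ + 1 ℤ.+ T)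
  minus = solve-∀
  plus : ∀ A N K T → ℤ.- A ℤ.+ (N ℤ.- K ℤ.- A ℤ.+ + 1 ℤ.+ T) ≡ (N ℤ.+ + 1 ℤ.+ T) ℤ.- (A ℤ.+ K ℤ.+ A)
  plus = solve-∀

bEdge-shifted : ∀ n k t M I E {x y} → x < n → y < n →
  ReducesTo (2 * n) (M + I + 2 * k + M) (n + E + 1 + 2 * t) (1 + 2 * x) →
  ReducesTo (2 * n) (I + n + E + 1 + 2 * t) (2 * k) (1 + 2 * y) →
  bEdge n k (+ (M + I)) (+ M ℤ.- + E) t ≡ (vertex x , vertex y)
bEdge-shifted n k t M I E x<n y<n x-reduces y-reduces = cong₂ _,_
  (trans (cong (pos n) (trans (minus (+ M) (+ I) (+ E) (+ n) (+ (2 * k)) (+ (2 * t)))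
                              (m-n≡m⊖n (M + I + 2 * k + M) (n + E + 1 + 2 * t))))
         (pos-vertex n (M + I + 2 * k + M) (n + E + 1 + 2 * t) x<n x-reduces))
  (trans (cong (pos n) (trans (plus (+ M) (+ I) (+ E) (+ n) (+ (2 * k)) (+ (2 * t)))
                              (m-n≡m⊖n (I + n + E + 1 + 2 * t) (2 * k))))
         (pos-vertex n (I + n + E + 1 + 2 * t) (2 * k) y<n y-reduces))
  where
  minus : ∀ M I E N K T → (M ℤ.+ I) ℤ.- (N ℤ.- K ℤ.- (M ℤ.- E) ℤ.+ + 1 ℤ.+ T)
                          ≡ (M ℤ.+ I ℤ.+ K ℤ.+ M) ℤ.- (N ℤ.+ E ℤ.+ + 1 ℤ.+ T)
  minus = solve-∀
  plus : ∀ M I E N K T → (M ℤ.+ I) ℤ.+ (N ℤ.- K ℤ.- (M ℤ.- E) ℤ.+ + 1 ℤ.+ T)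
                         ≡ (I ℤ.+ N ℤ.+ E ℤ.+ + 1 ℤ.+ T) ℤ.- K
  plus = solve-∀

-- B_{a,a} with m = a + b: the t-th edge joins vertices m + t and h + k − 1 + a − t.
central-nonneg : ∀ a b t r → let m = a + b; k = suc (t + r) in
  AdmissibleChord m k (bEdge (2 * (m + k)) k (+ a) (+ a) t)
central-nonneg a b t r = chord admissible (inj₂
  (bEdge-nonneg (2 * (a + b + suc (t + r))) (suc (t + r)) t a a w<2h (<-trans u<w w<2h)
    (inj₂ (solve (a ∷ b ∷ t ∷ r ∷ []))) (inj₁ (solve (a ∷ b ∷ t ∷ r ∷ [])))))
  where
  admissible : Admissible (a + b) (suc (t + r)) (a + b + t) (2 * a + b + t + 2 * r + 1)
  admissible = record
    { u<w            = <-witness (a + 2 * r) (solve (a ∷ b ∷ t ∷ r ∷ []))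
    ; w<2h           = <-witness (b + t) (solve (a ∷ b ∷ t ∷ r ∷ []))
    ; lower-long     = λ w<h → ⊥-elim (refute-< w<h (a + r) (solve (a ∷ b ∷ t ∷ r ∷ [])))
    ; upper-long     = λ h≤u → ⊥-elim (refute-≤ h≤u r (solve (a ∷ b ∷ t ∷ r ∷ [])))
    ; crossing-short = λ u<m → ⊥-elim (refute-< u<m t (solve (a ∷ b ∷ t ∷ r ∷ [])))
    }
  open Admissible admissible

-- B_{−1−a,1+a} with m = 1 + a + b: the t-th edge joins vertices b + t and h + k − 1 − t.
central-neg : ∀ a b t r → let m = suc a + b; k = suc (t + r) in
  AdmissibleChord m k (bEdge (2 * (m + k)) k -[1+ a ] (+ suc a) t)
central-neg a b t r = chord admissible (inj₂
  (bEdge-neg (2 * (suc a + b + suc (t + r))) (suc (t + r)) t a w<2h (<-trans u<w w<2h)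
    (inj₂ (solve (a ∷ b ∷ t ∷ r ∷ []))) (inj₁ (solve (a ∷ b ∷ t ∷ r ∷ [])))))
  where
  admissible : Admissible (suc a + b) (suc (t + r)) (b + t) (suc a + b + t + 2 * r + 1)
  admissible = record
    { u<w            = <-witness (suc (a + 2 * r)) (solve (a ∷ b ∷ t ∷ r ∷ []))
    ; w<2h           = <-witness (suc (a + b + t)) (solve (a ∷ b ∷ t ∷ r ∷ []))
    ; lower-long     = λ w<h → ⊥-elim (refute-< w<h r (solve (a ∷ b ∷ t ∷ r ∷ [])))
    ; upper-long     = λ h≤u → ⊥-elim (refute-≤ h≤u (suc (a + r)) (solve (a ∷ b ∷ t ∷ r ∷ [])))
    ; crossing-short = λ _ _ → <-witness t (solve (a ∷ b ∷ t ∷ r ∷ []))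
    }
  open Admissible admissible

-- B_{m+i,m−e} with i = e + 2s and t < s: the t-th edge joins vertices s − t − 1 and m + s + e + t.
outer-t<s : ∀ m e t r z → let s = suc (t + r); k = s + e + z in
  AdmissibleChord m k (bEdge (2 * (m + k)) k (+ (m + (e + s * 2))) (+ m ℤ.- + e) t)
outer-t<s m e t r z = chord admissible (inj₁
  (bEdge-shifted (2 * (m + (suc (t + r) + e + z))) (suc (t + r) + e + z) t m (e + suc (t + r) * 2) e
    (<-trans u<w w<2h) w<2h
    (inj₁ (solve (m ∷ e ∷ t ∷ r ∷ z ∷ []))) (inj₁ (solve (m ∷ e ∷ t ∷ r ∷ z ∷ [])))))
  where
  admissible : Admissible m (suc (t + r) + e + z) r (m + suc (t + r) + e + t)
  admissible = record
    { u<w            = <-witness (m + e + 2 * t) (solve (m ∷ e ∷ t ∷ r ∷ z ∷ []))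
    ; w<2h           = <-witness (m + r + e + 2 * z) (solve (m ∷ e ∷ t ∷ r ∷ z ∷ []))
    ; lower-long     = λ _ → ≤-witness (e + 2 * t) (solve (m ∷ e ∷ t ∷ r ∷ z ∷ []))
    ; upper-long     = λ h≤u → ⊥-elim (refute-≤ h≤u (m + t + e + z) (solve (m ∷ e ∷ t ∷ r ∷ z ∷ [])))
    ; crossing-short = λ _ _ → <-witness (r + e + 2 * z) (solve (m ∷ e ∷ t ∷ r ∷ z ∷ []))
    }
  open Admissible admissible

-- B_{m+i,m−e} with i = e + 2s and s ≤ t: the t-th edge joins vertices m + s + e + t and
-- 2h − 1 − (t − s), the latter after wrapping around.
outer-s≤t : ∀ m′ e s r q → e ≤ 1 → let m = suc m′; t = s + r; k = suc (t + q) in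
  AdmissibleChord m k (bEdge (2 * (m + k)) k (+ (m + (e + s * 2))) (+ m ℤ.- + e) t)
outer-s≤t m′ e s r q e≤1 = chord admissible (inj₂
  (bEdge-shifted (2 * (suc m′ + suc (s + r + q))) (suc (s + r + q)) (s + r) (suc m′) (e + s * 2) e
    w<2h (<-trans u<w w<2h)
    (inj₂ (solve (m′ ∷ e ∷ s ∷ r ∷ q ∷ []))) (inj₁ (solve (m′ ∷ e ∷ s ∷ r ∷ q ∷ [])))))
  where
  u≤u₁ : suc m′ + s + e + (s + r) ≤ suc m′ + s + 1 + (s + r)
  u≤u₁ = +-monoˡ-≤ (s + r) (+-monoʳ-≤ (suc m′ + s) e≤1)
  u₁<w : suc m′ + s + 1 + (s + r) < 2 * suc m′ + 2 * s + r + 2 * q + 1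
  u₁<w = <-witness (m′ + 2 * q) (solve (m′ ∷ e ∷ s ∷ r ∷ q ∷ []))
  u₁+m≤w : suc m′ + s + 1 + (s + r) + suc m′ ≤ 2 * suc m′ + 2 * s + r + 2 * q + 1
  u₁+m≤w = ≤-witness (2 * q) (solve (m′ ∷ e ∷ s ∷ r ∷ q ∷ []))
  admissible : Admissible (suc m′) (suc (s + r + q))
                          (suc m′ + s + e + (s + r)) (2 * suc m′ + 2 * s + r + 2 * q + 1)
  admissible = record
    { u<w            = ≤-<-trans u≤u₁ u₁<w
    ; w<2h           = <-witness r (solve (m′ ∷ e ∷ s ∷ r ∷ q ∷ []))
    ; lower-long     = λ w<h → ⊥-elim (refute-< w<h (suc m′ + s + q) (solve (m′ ∷ e ∷ s ∷ r ∷ q ∷ [])))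
    ; upper-long     = λ _ → ≤-trans (+-monoˡ-≤ (suc m′) u≤u₁) u₁+m≤w
    ; crossing-short = λ u<m → ⊥-elim (refute-< u<m (s + e + (s + r))
                                (solve (m′ ∷ e ∷ s ∷ r ∷ q ∷ [])))
    }
  open Admissible admissible

half-gap : ∀ m k → (2 * (m + k) ∸ 2 * k) / 2 ≡ m
half-gap m k = begin
  (2 * (m + k) ∸ 2 * k) / 2    ≡⟨ cong (λ x → (x ∸ 2 * k) / 2) (*-distribˡ-+ 2 m k) ⟩
  (2 * m + 2 * k ∸ 2 * k) / 2  ≡⟨ cong (_/ 2) (m+n∸n≡m (2 * m) (2 * k)) ⟩
  2 * m / 2                    ≡⟨ cong (_/ 2) (*-comm 2 m) ⟩
  m * 2 / 2                    ≡⟨ m*n/n≡m m 2 ⟩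
  m                            ∎
  where open ≡-Reasoning

halve-≤ : ∀ {e s k} → e ≤ 1 → e + s * 2 ≤ 2 * k → s + e ≤ k
halve-≤ {0} {s} {k} _ le =
  subst (_≤ k) (sym (+-identityʳ s)) (*-cancelʳ-≤ s k 2 (subst (s * 2 ≤_) (*-comm 2 k) le))
halve-≤ {1} {s} {k} _ le =
  subst (_≤ k) (+-comm 1 s) (*-cancelʳ-< 2 s k (subst (suc (s * 2) ≤_) (*-comm 2 k) le))
halve-≤ {suc (suc _)} (s≤s ())

outer-admissible : ∀ {m k e s E} → 1 ≤ m → e ≤ 1 → s + e ≤ k →
  InB (2 * (m + k)) k (+ (m + (e + s * 2))) (+ m ℤ.- + e) E → AdmissibleChord m k E
outer-admissible {suc m′} {e = e} {s} (s≤s z≤n) e≤1 s+e≤k (t , t<k , orientation) with t <? s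
... | yes t<s with r , refl ← m≤n⇒∃[o]m+o≡n t<s with z , refl ← m≤n⇒∃[o]m+o≡n s+e≤k =
  chord-reorient (outer-t<s (suc m′) e t r z) orientation
... | no t≮s with r , refl ← m≤n⇒∃[o]m+o≡n (≮⇒≥ t≮s) with q , refl ← m≤n⇒∃[o]m+o≡n t<k =
  chord-reorient (outer-s≤t m′ e s r q e≤1) orientation

edge-admissible : ∀ {m k e} → 1 ≤ m → IsEdgeG (2 * (m + k)) k e → AdmissibleChord m k e
edge-admissible {m} {k} _ (inj₁ (+ a , _ , +≤+ a≤m₀ , t , t<k , orientation))
  with b , refl ← m≤n⇒∃[o]m+o≡n (subst (a ≤_) (half-gap m k) a≤m₀)
  with r , refl ← m≤n⇒∃[o]m+o≡n t<k =
  chord-reorient (central-nonneg a b t r) orientation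
edge-admissible {m} {k} _ (inj₁ (-[1+ a ] , -m₀≤j , _ , t , t<k , orientation))
  with +≤+ a<m₀ ← neg-cancel-≤ -m₀≤j
  with b , refl ← m≤n⇒∃[o]m+o≡n (subst (suc a ≤_) (half-gap m k) a<m₀)
  with r , refl ← m≤n⇒∃[o]m+o≡n t<k =
  chord-reorient (central-neg a b t r) orientation
edge-admissible {m} {k} {E} 1≤m (inj₂ (i , i≤2k , inB)) =
  outer-admissible {e = i % 2} {s = i / 2} 1≤m e≤1 (halve-≤ e≤1 (subst (_≤ 2 * k) i≡ i≤2k))
    (subst (λ i′ → InB (2 * (m + k)) k (+ (m + i′)) (+ m ℤ.- + ε i) E) i≡
      (subst (λ m₀ → InB (2 * (m + k)) k (+ (m₀ + i)) (+ m₀ ℤ.- + ε i) E) (half-gap m k) inB))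
  where
  e≤1 = ≤-pred (m%n<n i 2)
  i≡ = m≡m%n+[m/n]*n i 2

halve-< : ∀ {k q} → 2 * k + 2 ≤ q * 2 → k < q
halve-< {k} {q} le =
  *-cancelʳ-< 2 k q (<-≤-trans (subst (_< 2 * k + 2) (*-comm 2 k) (m<m+n (2 * k) z<s)) le)

even-decomposition : ∀ {n k} → 2 ∣ n → 2 * k + 2 ≤ n → ∃ λ m′ → n ≡ 2 * (suc m′ + k)
even-decomposition {k = k} (divides q refl) 2k+2≤n
  with m′ , refl ← m≤n⇒∃[o]m+o≡n (halve-< {k} {q} 2k+2≤n) =
  m′ , solve (k ∷ m′ ∷ [])

proposition1 : (n k : ℕ) → 2 ∣ n → 1 ≤ k → 2 * k + 2 ≤ n →
    ¬ HasDisjointEdges n k (suc k)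
proposition1 n k 2∣n _ 2k+2≤n (edge , is-edge , disjoint)
  with m′ , refl ← even-decomposition {n} {k} 2∣n 2k+2≤n =
  no-admissible-non-crossing-family m′ k (admissible ∘ chord-of)
    (λ {x} {y} x≢y → chords-non-crossing (chord-of x) (chord-of y) (disjoint x y x≢y))
  where
  open AdmissibleChord
  chord-of : ∀ x → AdmissibleChord (suc m′) k (edge x)
  chord-of x = edge-admissible (s≤s z≤n) (is-edge x)
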